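{- Let $a_1,\dots,a_k$ be integers ($k\ge3$) such that the equation $\sum_{i=1}^k a_ix_i=0$ is graph-regular. Then there is a nonempty set $I\subsetneq[k]$ such that $\sum_{i\in I}a_i=\sum_{j\notin I}a_j=0$.
   Context: Write $[N]=\{1,\dots,N\}$. For an integer matrix $A$ (here a single row $(a_1,\dots,a_k)$) with $k\ge 3$ columns, the equation $A\mathbf{x}=\mathbf{0}$ is called graph-regular if there is a function $N_A(r)$ such that for every $r\in\mathbb{N}$ and every $N>N_A(r)$, every $r$-coloring of the edges of the complete graph on vertex set $[N]$ admits a vector $\mathbf{x}=(x(1),\dots,x(k))\in[N]^k$ with $A\mathbf{x}=\mathbf{0}$ such that the values $x(1),\dots,x(k)$ are pairwise distinct and all edges $\{x(i),x(j)\}$ ($i\ne j$) have the same color. -}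

module Defs where

open import Data.Nat using (ℕ; suc; _≤_; _<_)
open import Data.Integer using (ℤ; +_; _*_; _+_)
open import Data.Fin using (Fin)
open import Data.Bool using (Bool; true; false)
open import Data.Product using (Σ; ∃; _×_; _,_; proj₁)
open import Relation.Binary.PropositionalEquality using (_≡_; _≢_)

sumFin : ∀ {k} → (Fin k → ℤ) → ℤ
sumFin {ℕ.zero} f = + 0
sumFin {suc k} f = f Fin.zero + sumFin (λ i → f (Fin.suc i))

linComb : ∀ {k} → (Fin k → ℤ) → (Fin k → ℕ) → ℤ
linComb a x = sumFin (λ i → a i * + (x i))

InRange : ∀ {k} → ℕ → (Fin k → ℕ) → Set
InRange N x = ∀ i → (1 ≤ x i) × (x i ≤ N)

-- an r-colouring of the edges of the complete graph on [N]:
-- a colour for each pair, symmetric on distinct vertices of [N]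
EdgeColouring : ℕ → ℕ → Set
EdgeColouring r N =
  Σ (ℕ → ℕ → Fin r) λ c →
    ∀ u v → 1 ≤ u → u ≤ N → 1 ≤ v → v ≤ N → c u v ≡ c v u

MonoSolution : ∀ {k r} → (Fin k → ℤ) → ℕ → (ℕ → ℕ → Fin r) → (Fin k → ℕ) → Set
MonoSolution {k} {r} a N c x =
  InRange N x × (linComb a x ≡ + 0) ×
  ((i j : Fin k) → i ≢ j → x i ≢ x j) ×
  Σ (Fin r) λ col → (i j : Fin k) → i ≢ j → c (x i) (x j) ≡ col

GraphRegular : ∀ {k} → (Fin k → ℤ) → Set
GraphRegular a =
  Σ (ℕ → ℕ) λ NA → ∀ r N → NA r < N →
    (C : EdgeColouring r N) →
    ∃ λ x → MonoSolution a N (proj₁ C) x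

sumIn : ∀ {k} → (Fin k → Bool) → (Fin k → ℤ) → ℤ
sumIn I a = sumFin (λ i → if′ (I i) (a i))
  where
  if′ : Bool → ℤ → ℤ
  if′ true z = z
  if′ false z = + 0

sumOut : ∀ {k} → (Fin k → Bool) → (Fin k → ℤ) → ℤ
sumOut I a = sumFin (λ i → if′ (I i) (a i))
  where
  if′ : Bool → ℤ → ℤ
  if′ true z = + 0
  if′ false z = z

module Submission where

-- Fix a prime p > Σ |aⱼ|.  Every z ≥ 1 factors as z = p^v(z)·u(z) with p ∤ u(z); write
-- d(z) = u(z) mod p for its lowest nonzero base-p digit.  Colour an edge {lo < hi} of the
-- complete graph by the quadruple (d(lo), d(hi), d(hi − lo), [v(lo) = v(hi)]), which uses
-- 2p³ colours.  Graph-regularity yields a monochromatic solution x with distinct entries.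
-- Comparing the pair colours at the smallest entry x_min and two further entries (k ≥ 3)
-- shows: all xⱼ have the same digit, the gaps xⱼ − x_min (j ≠ min) all have the same digit,
-- and the valuations v(xⱼ) are either all equal or pairwise distinct.
--
-- The engine is the lowest-digit lemma (level-sum-vanishes): if Σ aⱼyⱼ = 0 and, read at
-- p-adic level t, the terms in a set I have digit e (p ∤ e) while the others vanish modulo
-- p^(t+1), then p divides e·Σ_{j∈I} aⱼ, so Σ_{j∈I} aⱼ = 0 because its size is below p.
--  * Distinct valuations: I = {an index of least valuation with aⱼ ≠ 0} gives a
--    contradiction, so a = 0 and any split works.
--  * Equal valuations: I = everything gives Σ aⱼ = 0; hence yⱼ = xⱼ − x_min is again a
--    solution, and I = {j ≠ min : v(yⱼ) minimal} is the required proper zero-sum subset.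

open import Defs
open import Data.Nat.Base as ℕ
  using (ℕ; zero; suc; _≤_; _<_; _^_; _∸_; _⊓_; _⊔_; _!; NonZero; NonTrivial; z≤n; s≤s)
import Data.Nat.Properties as ℕP
open import Data.Nat.DivMod using (_%_; _/_; m≡m%n+[m/n]*n; m%n<n)
open import Data.Nat.Divisibility
  using (_∣_; _∣?_; divides; ∣-refl; ∣-trans; m∣m*n; ∣m+n∣m⇒∣n; ∣n∣m%n⇒∣m; >⇒∤; ∣1⇒≡1; m≤n⇒m!∣n!)
open import Data.Nat.Primality using (Prime; euclidsLemma; ¬prime[1]; prime⇒nonZero; prime⇒nonTrivial)
open import Data.Nat.Primality.Factorisation using (factorise; PrimeFactorisation)
open import Data.Nat.ListAction using (product)
open import Data.Nat.Induction using (<-wellFounded)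
import Data.Nat.Tactic.RingSolver as ℕ-Solver
open import Data.Integer.Base as ℤ using (ℤ; +_; _+_; _*_; -_; _-_; ∣_∣)
import Data.Integer.Properties as ℤP
open import Data.Integer.Tactic.RingSolver using (solve-∀)
open import Data.Fin.Base as Fin using (Fin; punchIn; fromℕ<; toℕ; combine)
open import Data.Fin.Patterns using (0F; 1F)
open import Data.Fin.Properties
  using (_≟_; any?; punchInᵢ≢i; punchIn-injective; combine-injective; toℕ-fromℕ<)
open import Data.Bool.Base using (Bool; true; false)
open import Data.Product.Base using (Σ; ∃; ∃₂; _×_; _,_; proj₁; proj₂)
open import Data.Sum.Base using (_⊎_; inj₁; inj₂)
open import Data.Empty using (⊥-elim)
open import Data.Unit.Base using (⊤; tt)
open import Data.List.Base using ([]; _∷_)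
open import Data.List.Relation.Unary.All using (All; _∷_)
open import Function.Base using (_∘_)
open import Induction.WellFounded using (Acc; acc)
open import Relation.Nullary using (¬_; Dec; yes; no; does; ¬?; _×-dec_)
open import Relation.Nullary.Decidable using (dec-true; dec-false)
open import Relation.Unary using (Decidable)
open import Relation.Binary.Definitions using (tri<; tri≈; tri>)
open import Relation.Binary.PropositionalEquality
  using (_≡_; _≢_; refl; sym; trans; cong; cong₂; subst; subst₂; module ≡-Reasoning)

open ≡-Reasoning

ZeroSumSplit : ∀ {k} → (Fin k → ℤ) → Set
ZeroSumSplit {k} a = Σ (Fin k → Bool) λ I →
  (∃ λ i → I i ≡ true) × (∃ λ j → I j ≡ false) × (sumIn I a ≡ + 0) × (sumOut I a ≡ + 0)

sumFin-cong : ∀ {k} {f g : Fin k → ℤ} → (∀ j → f j ≡ g j) → sumFin f ≡ sumFin g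
sumFin-cong {zero}  f≡g = refl
sumFin-cong {suc k} f≡g = cong₂ _+_ (f≡g 0F) (sumFin-cong (f≡g ∘ Fin.suc))

sumFin-zero : ∀ {k} (f : Fin k → ℤ) → (∀ j → f j ≡ + 0) → sumFin f ≡ + 0
sumFin-zero {zero}  f f≡0 = refl
sumFin-zero {suc k} f f≡0 =
  cong₂ _+_ (f≡0 0F) (sumFin-zero (f ∘ Fin.suc) (f≡0 ∘ Fin.suc))

sumFin-+ : ∀ {k} (f g : Fin k → ℤ) → sumFin (λ j → f j + g j) ≡ sumFin f + sumFin g
sumFin-+ {zero}  f g = refl
sumFin-+ {suc k} f g = begin
  f 0F + g 0F + sumFin (λ j → f (Fin.suc j) + g (Fin.suc j))
    ≡⟨ cong (_+_ (f 0F + g 0F)) (sumFin-+ (f ∘ Fin.suc) (g ∘ Fin.suc)) ⟩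
  f 0F + g 0F + (sumFin (f ∘ Fin.suc) + sumFin (g ∘ Fin.suc))
    ≡⟨ interchange (f 0F) (g 0F) _ _ ⟩
  f 0F + sumFin (f ∘ Fin.suc) + (g 0F + sumFin (g ∘ Fin.suc)) ∎
  where
  interchange : ∀ a b c d → a + b + (c + d) ≡ a + c + (b + d)
  interchange = solve-∀

sumFin-*ʳ : ∀ {k} (f : Fin k → ℤ) c → sumFin (λ j → f j * c) ≡ sumFin f * c
sumFin-*ʳ {zero}  f c = refl
sumFin-*ʳ {suc k} f c = begin
  f 0F * c + sumFin (λ j → f (Fin.suc j) * c) ≡⟨ cong (_+_ (f 0F * c)) (sumFin-*ʳ (f ∘ Fin.suc) c) ⟩
  f 0F * c + sumFin (f ∘ Fin.suc) * c         ≡⟨ ℤP.*-distribʳ-+ c (f 0F) _ ⟨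
  (f 0F + sumFin (f ∘ Fin.suc)) * c           ∎

linComb-shift : ∀ {k} (a : Fin k → ℤ) (x : Fin k → ℕ) c → (∀ j → c ≤ x j) →
                sumFin a ≡ + 0 → linComb a x ≡ + 0 → linComb a (λ j → x j ∸ c) ≡ + 0
linComb-shift a x c c≤x Σa≡0 solution = begin
  linComb a (λ j → x j ∸ c)                  ≡⟨ sumFin-cong term ⟩
  sumFin (λ j → a j * + x j + a j * - + c)  ≡⟨ sumFin-+ (λ j → a j * + x j) (λ j → a j * - + c) ⟩
  linComb a x + sumFin (λ j → a j * - + c)   ≡⟨ cong₂ _+_ solution (sumFin-*ʳ a (- + c)) ⟩
  + 0 + sumFin a * - + c                     ≡⟨ cong (λ s → + 0 + s * - + c) Σa≡0 ⟩
  + 0                                        ∎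
  where
  term : ∀ j → a j * + (x j ∸ c) ≡ a j * + x j + a j * - + c
  term j = begin
    a j * + (x j ∸ c)   ≡⟨ cong (a j *_) (trans (ℤP.m-n≡m⊖n (x j) c) (ℤP.⊖-≥ (c≤x j))) ⟨
    a j * (+ x j - + c) ≡⟨ ℤP.*-distribˡ-+ (a j) (+ x j) (- + c) ⟩
    a j * + x j + a j * - + c ∎

select : Bool → ℤ → ℤ
select true  z = z
select false z = + 0

sumIn-select : ∀ {k} (I : Fin k → Bool) (a : Fin k → ℤ) →
               sumIn I a ≡ sumFin (λ j → select (I j) (a j))
sumIn-select {zero}  I a = refl
sumIn-select {suc k} I a with I 0F
... | true  = cong (_+_ (a 0F)) (sumIn-select (I ∘ Fin.suc) (a ∘ Fin.suc))
... | false = cong (_+_ (+ 0)) (sumIn-select (I ∘ Fin.suc) (a ∘ Fin.suc))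

sumIn+sumOut : ∀ {k} (I : Fin k → Bool) (a : Fin k → ℤ) → sumIn I a + sumOut I a ≡ sumFin a
sumIn+sumOut {zero}  I a = refl
sumIn+sumOut {suc k} I a with I 0F
... | true  = trans (shuffle (a 0F) (sumIn I′ a′) (sumOut I′ a′)) (cong (_+_ (a 0F)) (sumIn+sumOut I′ a′))
  where
  I′ = I ∘ Fin.suc
  a′ = a ∘ Fin.suc
  shuffle : ∀ x s t → x + s + (+ 0 + t) ≡ x + (s + t)
  shuffle = solve-∀
... | false = trans (shuffle (a 0F) (sumIn I′ a′) (sumOut I′ a′)) (cong (_+_ (a 0F)) (sumIn+sumOut I′ a′))
  where
  I′ = I ∘ Fin.suc
  a′ = a ∘ Fin.suc
  shuffle : ∀ x s t → + 0 + s + (x + t) ≡ x + (s + t)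
  shuffle = solve-∀

complement-vanishes : ∀ {k} (I : Fin k → Bool) (a : Fin k → ℤ) →
                      sumFin a ≡ + 0 → sumIn I a ≡ + 0 → sumOut I a ≡ + 0
complement-vanishes I a total inside = begin
  sumOut I a               ≡⟨ ℤP.+-identityˡ (sumOut I a) ⟨
  + 0 + sumOut I a         ≡⟨ cong (_+ sumOut I a) inside ⟨
  sumIn I a + sumOut I a   ≡⟨ sumIn+sumOut I a ⟩
  sumFin a                 ≡⟨ total ⟩
  + 0                      ∎

sumIn-single : ∀ {k} (a : Fin k → ℤ) i → sumIn (λ j → does (j ≟ i)) a ≡ a i
sumIn-single {suc k} a 0F = begin
  a 0F + sumFin {k} (λ _ → + 0) ≡⟨ cong (_+_ (a 0F)) (sumFin-zero {k} (λ _ → + 0) (λ _ → refl)) ⟩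
  a 0F + + 0                ≡⟨ ℤP.+-identityʳ (a 0F) ⟩
  a 0F                      ∎
sumIn-single {suc k} a (Fin.suc i) =
  trans (ℤP.+-identityˡ _) (sumIn-single (a ∘ Fin.suc) i)

absSum : ∀ {k} → (Fin k → ℤ) → ℕ
absSum {zero}  a = 0
absSum {suc k} a = ∣ a 0F ∣ ℕ.+ absSum (a ∘ Fin.suc)

∣sumIn∣≤absSum : ∀ {k} (I : Fin k → Bool) (a : Fin k → ℤ) → ∣ sumIn I a ∣ ≤ absSum a
∣sumIn∣≤absSum {zero}  I a = z≤n
∣sumIn∣≤absSum {suc k} I a with I 0F
... | true  = ℕP.≤-trans (ℤP.∣i+j∣≤∣i∣+∣j∣ (a 0F) (sumIn (I ∘ Fin.suc) (a ∘ Fin.suc)))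
                (ℕP.+-monoʳ-≤ ∣ a 0F ∣ (∣sumIn∣≤absSum (I ∘ Fin.suc) (a ∘ Fin.suc)))
... | false = ℕP.≤-trans (ℤP.∣i+j∣≤∣i∣+∣j∣ (+ 0) (sumIn (I ∘ Fin.suc) (a ∘ Fin.suc)))
                (ℕP.≤-trans (∣sumIn∣≤absSum (I ∘ Fin.suc) (a ∘ Fin.suc)) (ℕP.m≤n+m _ ∣ a 0F ∣))

does-true : ∀ {A : Set} (A? : Dec A) → does A? ≡ true → A
does-true (yes a) _ = a

does-false : ∀ {A : Set} (A? : Dec A) → does A? ≡ false → ¬ A
does-false (no ¬a) _ = ¬a

argminOn : ∀ {n} {P : Fin n → Set} → Decidable P → (f : Fin n → ℕ) →
           ∃ P → ∃ λ i → P i × (∀ j → P j → f i ≤ f j)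
argminOn {P = P} P? f (i , Pi) = descend i Pi (<-wellFounded (f i))
  where
  descend : ∀ i → P i → Acc _<_ (f i) → ∃ λ m → P m × (∀ j → P j → f m ≤ f j)
  descend i Pi (acc smaller) with any? (λ j → P? j ×-dec (f j ℕP.<? f i))
  ... | yes (j , Pj , fj<fi) = descend j Pj (smaller fj<fi)
  ... | no  none             = i , Pi , λ j Pj → ℕP.≮⇒≥ (λ fj<fi → none (j , Pj , fj<fi))

two-others : ∀ {k} (i : Fin (suc (suc (suc k)))) → ∃₂ λ j j' → j ≢ i × j' ≢ i × j ≢ j'
two-others i = punchIn i 0F , punchIn i 1F , punchInᵢ≢i i 0F , punchInᵢ≢i i 1F ,
               λ eq → 0≢1 (punchIn-injective i 0F 1F eq)
  where
  0≢1 : ∀ {k} → Fin.zero {suc k} ≢ 1F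
  0≢1 ()

n∣n! : ∀ n .{{_ : NonZero n}} → n ∣ n !
n∣n! (suc n) = m∣m*n (n !)

-- Euclid: every prime factor of n! + 1 exceeds n.
prime-above : ∀ n → ∃ λ q → Prime q × n < q
prime-above n = first-factor (factors F) (isFactorisation F) (factorsPrime F)
  where
  F : PrimeFactorisation (suc (n !))
  F = factorise (suc (n !))
  open PrimeFactorisation
  first-factor : ∀ qs → suc (n !) ≡ product qs → All Prime qs → ∃ λ q → Prime q × n < q
  first-factor []       n!+1≡1 _ = ⊥-elim (ℕP.<⇒≢ (ℕP.1≤n! n) (sym (ℕP.suc-injective n!+1≡1)))
  first-factor (q ∷ qs) n!+1≡Π (q-prime ∷ _) =
    q , q-prime , ℕP.≰⇒> (λ q≤n → ¬prime[1] (subst Prime (∣1⇒≡1 (q∣1 q≤n)) q-prime))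
    where
    instance
      q≢0 : NonZero q
      q≢0 = prime⇒nonZero q-prime
    q∣n!+1 : q ∣ n ! ℕ.+ 1
    q∣n!+1 = divides (product qs) (trans (ℕP.+-comm (n !) 1) (trans n!+1≡Π (ℕP.*-comm q _)))
    q∣1 : q ≤ n → q ∣ 1
    q∣1 q≤n = ∣m+n∣m⇒∣n q∣n!+1 (∣-trans (n∣n! q) (m≤n⇒m!∣n! q≤n))

∣∧<⇒≡0 : ∀ {p n} → p ∣ n → n < p → n ≡ 0
∣∧<⇒≡0 {n = zero}  _   _   = refl
∣∧<⇒≡0 {n = suc n} p∣n n<p = ⊥-elim (>⇒∤ n<p p∣n)

multiple-of-prime : ∀ {p e} {s : ℤ} → Prime p → ¬ p ∣ e → ∣ s ∣ < p → p ∣ ∣ s * + e ∣ → s ≡ + 0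
multiple-of-prime {p} {e} {s} p-prime p∤e small p∣se
  with euclidsLemma ∣ s ∣ e p-prime (subst (p ∣_) (ℤP.abs-* s (+ e)) p∣se)
... | inj₁ p∣s = ℤP.∣i∣≡0⇒i≡0 (∣∧<⇒≡0 p∣s small)
... | inj₂ p∣e = ⊥-elim (p∤e p∣e)

module PAdic (p : ℕ) .{{_ : NonTrivial p}} where

  instance
    p≢0 : NonZero p
    p≢0 = ℕ.nonTrivial⇒nonZero p

  -- strip f z = (v , u) with z = p^v·u and p ∤ u, provided 1 ≤ z ≤ f (f is the fuel).
  strip : ℕ → ℕ → ℕ × ℕ
  strip zero    z       = 0 , z
  strip (suc f) zero    = 0 , 0
  strip (suc f) (suc z) with p ∣? suc z
  ... | yes (divides q _) = let (v , u) = strip f q in suc v , u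
  ... | no  _             = 0 , suc z

  -- The specification of strip, by induction on the fuel: when p ∣ z, z = q·p with q < z.
  strip-spec : ∀ f z → 1 ≤ z → z ≤ f →
               z ≡ p ^ proj₁ (strip f z) ℕ.* proj₂ (strip f z) × ¬ p ∣ proj₂ (strip f z)
  strip-spec zero    (suc z) _ ()
  strip-spec (suc f) (suc z) _ (s≤s z≤f) with p ∣? suc z
  ... | no  p∤z              = sym (ℕP.*-identityˡ (suc z)) , p∤z
  ... | yes (divides (suc q) z≡qp) = decomposition , proj₂ rest
    where
    q<z : suc q < suc z
    q<z = subst (suc q <_) (sym z≡qp) (ℕP.m<m*n (suc q) p (ℕ.nonTrivial⇒n>1 p))
    v u : ℕ
    v = proj₁ (strip f (suc q))
    u = proj₂ (strip f (suc q))
    rest : suc q ≡ p ^ v ℕ.* u × ¬ p ∣ u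
    rest = strip-spec f (suc q) (s≤s z≤n) (ℕP.≤-trans (ℕP.<⇒≤pred q<z) z≤f)
    decomposition : suc z ≡ p ℕ.* p ^ v ℕ.* u
    decomposition = begin
      suc z                 ≡⟨ z≡qp ⟩
      suc q ℕ.* p           ≡⟨ cong (ℕ._* p) (proj₁ rest) ⟩
      p ^ v ℕ.* u ℕ.* p     ≡⟨ rotate (p ^ v) u p ⟩
      p ℕ.* p ^ v ℕ.* u     ∎
      where
      rotate : ∀ a b c → a ℕ.* b ℕ.* c ≡ c ℕ.* a ℕ.* b
      rotate = ℕ-Solver.solve-∀

  -- z = p^(valuation z) · unit z with p ∤ unit z; digit z is the lowest nonzero digit.
  valuation unit digit : ℕ → ℕ
  valuation z = proj₁ (strip z z)
  unit      z = proj₂ (strip z z)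
  digit     z = unit z % p

  p-adic-decomposition : ∀ {z} → 1 ≤ z → z ≡ p ^ valuation z ℕ.* unit z
  p-adic-decomposition {z} 1≤z = proj₁ (strip-spec z z 1≤z ℕP.≤-refl)

  digit-indivisible : ∀ {z} → 1 ≤ z → ¬ p ∣ digit z
  digit-indivisible {z} 1≤z p∣digit = proj₂ (strip-spec z z 1≤z ℕP.≤-refl) (∣n∣m%n⇒∣m ∣-refl p∣digit)

  -- DigitAt t z w: z ≡ w·p^t modulo p^(t+1), i.e. p^t ∣ z and z/p^t ≡ w (mod p).
  record DigitAt (t : ℕ) (z w : ℤ) : Set where
    constructor digitAt
    field
      carry    : ℤ
      equation : z ≡ (w + carry * + p) * + (p ^ t)

  digitAt-ℕ : ∀ {t z w} m → z ≡ (w ℕ.+ m ℕ.* p) ℕ.* p ^ t → DigitAt t (+ z) (+ w)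
  digitAt-ℕ {t} {z} {w} m z≡ = digitAt (+ m) (begin
    + z                                   ≡⟨ cong +_ z≡ ⟩
    + ((w ℕ.+ m ℕ.* p) ℕ.* p ^ t)         ≡⟨ ℤP.pos-* (w ℕ.+ m ℕ.* p) (p ^ t) ⟩
    + (w ℕ.+ m ℕ.* p) * + (p ^ t)         ≡⟨ cong (_* + (p ^ t)) (ℤP.pos-+ w (m ℕ.* p)) ⟩
    (+ w + + (m ℕ.* p)) * + (p ^ t)       ≡⟨ cong (λ u → (+ w + u) * + (p ^ t)) (ℤP.pos-* m p) ⟩
    (+ w + + m * + p) * + (p ^ t)         ∎)

  digitAt-lowest : ∀ {z} → 1 ≤ z → DigitAt (valuation z) (+ z) (+ digit z)
  digitAt-lowest {z} 1≤z = digitAt-ℕ (unit z / p) (begin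
    z                                            ≡⟨ p-adic-decomposition 1≤z ⟩
    p ^ valuation z ℕ.* unit z                   ≡⟨ cong (p ^ valuation z ℕ.*_) (m≡m%n+[m/n]*n (unit z) p) ⟩
    p ^ valuation z ℕ.* (digit z ℕ.+ unit z / p ℕ.* p) ≡⟨ ℕP.*-comm (p ^ valuation z) _ ⟩
    (digit z ℕ.+ unit z / p ℕ.* p) ℕ.* p ^ valuation z ∎)

  digitAt-level : ∀ {z t e} → 1 ≤ z → valuation z ≡ t → digit z ≡ e → DigitAt t (+ z) (+ e)
  digitAt-level 1≤z refl refl = digitAt-lowest 1≤z

  digitAt-above : ∀ {z t} → 1 ≤ z → t < valuation z → DigitAt t (+ z) (+ 0)
  digitAt-above {z} {t} 1≤z t<v = digitAt-ℕ (p ^ r ℕ.* unit z) (begin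
    z                                     ≡⟨ p-adic-decomposition 1≤z ⟩
    p ^ valuation z ℕ.* unit z            ≡⟨ cong (λ v → p ^ v ℕ.* unit z) (ℕP.m+[n∸m]≡n t<v) ⟨
    p ^ (suc t ℕ.+ r) ℕ.* unit z          ≡⟨ cong (ℕ._* unit z) (ℕP.^-distribˡ-+-* p (suc t) r) ⟩
    p ℕ.* p ^ t ℕ.* p ^ r ℕ.* unit z      ≡⟨ regroup p (p ^ t) (p ^ r) (unit z) ⟩
    p ^ r ℕ.* unit z ℕ.* p ℕ.* p ^ t      ∎)
    where
    r : ℕ
    r = valuation z ∸ suc t
    regroup : ∀ a b c d → a ℕ.* b ℕ.* c ℕ.* d ≡ c ℕ.* d ℕ.* a ℕ.* b
    regroup = ℕ-Solver.solve-∀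

  digitAt-zero : ∀ {t} → DigitAt t (+ 0) (+ 0)
  digitAt-zero = digitAt (+ 0) refl

  digitAt-scale : ∀ {t z w} c → DigitAt t z w → DigitAt t (c * z) (c * w)
  digitAt-scale {t} {z} {w} c (digitAt m z≡) = digitAt (c * m) (begin
    c * z                          ≡⟨ cong (c *_) z≡ ⟩
    c * ((w + m * + p) * + (p ^ t)) ≡⟨ distribute c w m (+ p) (+ (p ^ t)) ⟩
    (c * w + c * m * + p) * + (p ^ t) ∎)
    where
    distribute : ∀ c w m p q → c * ((w + m * p) * q) ≡ (c * w + c * m * p) * q
    distribute = solve-∀

  digitAt-+ : ∀ {t z z′ w w′} → DigitAt t z w → DigitAt t z′ w′ → DigitAt t (z + z′) (w + w′)
  digitAt-+ {t} {z} {z′} {w} {w′} (digitAt m z≡) (digitAt m′ z′≡) = digitAt (m + m′) (begin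
    z + z′                                                ≡⟨ cong₂ _+_ z≡ z′≡ ⟩
    (w + m * + p) * + (p ^ t) + (w′ + m′ * + p) * + (p ^ t) ≡⟨ collect w w′ m m′ (+ p) (+ (p ^ t)) ⟩
    (w + w′ + (m + m′) * + p) * + (p ^ t)                 ∎)
    where
    collect : ∀ w w′ m m′ p q → (w + m * p) * q + (w′ + m′ * p) * q ≡ (w + w′ + (m + m′) * p) * q
    collect = solve-∀

  digitAt-sum : ∀ {k t} {z w : Fin k → ℤ} → (∀ j → DigitAt t (z j) (w j)) → DigitAt t (sumFin z) (sumFin w)
  digitAt-sum {zero}  _ = digitAt-zero
  digitAt-sum {suc k} d = digitAt-+ (d 0F) (digitAt-sum (d ∘ Fin.suc))

  digit-of-zero : ∀ {t w} → DigitAt t (+ 0) w → p ∣ ∣ w ∣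
  digit-of-zero {t} {w} (digitAt m 0≡) = divides ∣ m ∣ (begin
    ∣ w ∣            ≡⟨ cong ∣_∣ w≡-mp ⟩
    ∣ - (m * + p) ∣  ≡⟨ ℤP.∣-i∣≡∣i∣ (m * + p) ⟩
    ∣ m * + p ∣      ≡⟨ ℤP.abs-* m (+ p) ⟩
    ∣ m ∣ ℕ.* p      ∎)
    where
    instance _ = ℕP.m^n≢0 p t
    w+mp≡0 : w + m * + p ≡ + 0
    w+mp≡0 = ℤP.*-cancelʳ-≡ _ (+ 0) (+ (p ^ t)) (sym 0≡)
    w≡-mp : w ≡ - (m * + p)
    w≡-mp = begin
      w                            ≡⟨ cancel w (m * + p) ⟩
      w + m * + p + - (m * + p)    ≡⟨ cong (_+ - (m * + p)) w+mp≡0 ⟩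
      + 0 + - (m * + p)            ≡⟨ ℤP.+-identityˡ _ ⟩
      - (m * + p)                  ∎
      where
      cancel : ∀ w y → w ≡ w + y + - y
      cancel = solve-∀

  data Level {k} (t e : ℕ) (I : Fin k → Bool) (a : Fin k → ℤ) (y : Fin k → ℕ) (j : Fin k) : Set where
    inside    : I j ≡ true  → DigitAt t (+ y j) (+ e) → Level t e I a y j
    inert     : I j ≡ false → a j ≡ + 0               → Level t e I a y j
    vanishing : I j ≡ false → DigitAt t (+ y j) (+ 0) → Level t e I a y j

  level-term : ∀ {k t e I a y} (j : Fin k) → Level t e I a y j →
               DigitAt t (a j * + y j) (select (I j) (a j) * + e)
  level-term {a = a} j (inside Ij≡true d) rewrite Ij≡true = digitAt-scale (a j) d
  level-term {a = a} j (inert Ij≡false aj≡0) rewrite Ij≡false | aj≡0 = digitAt-zero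
  level-term {t = t} {a = a} j (vanishing Ij≡false d) rewrite Ij≡false =
    subst (DigitAt t _) (ℤP.*-zeroʳ (a j)) (digitAt-scale (a j) d)

  -- The lowest-digit lemma: reading Σ aⱼyⱼ = 0 at level t gives p ∣ e·Σ_{I} aⱼ, so the
  -- coefficients in I sum to zero.
  level-sum-vanishes : ∀ {k t e I} {a : Fin k → ℤ} {y} → Prime p → absSum a < p → ¬ p ∣ e →
                       linComb a y ≡ + 0 → (∀ j → Level t e I a y j) → sumIn I a ≡ + 0
  level-sum-vanishes {t = t} {e} {I} {a} {y} p-prime small p∤e solution level =
    multiple-of-prime p-prime p∤e (ℕP.≤-<-trans (∣sumIn∣≤absSum I a) small) (digit-of-zero lowestDigit)
    where
    lowestDigit : DigitAt t (+ 0) (sumIn I a * + e)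
    lowestDigit = subst₂ (DigitAt t) solution
      (trans (sumFin-*ʳ (λ j → select (I j) (a j)) (+ e)) (cong (_* + e) (sym (sumIn-select I a))))
      (digitAt-sum (λ j → level-term j (level j)))

  digitᶠ : ℕ → Fin p
  digitᶠ z = fromℕ< (m%n<n (unit z) p)

  digitᶠ-injective : ∀ u v → digitᶠ u ≡ digitᶠ v → digit u ≡ digit v
  digitᶠ-injective u v eq =
    trans (sym (toℕ-fromℕ< (m%n<n (unit u) p))) (trans (cong toℕ eq) (toℕ-fromℕ< (m%n<n (unit v) p)))

  Colour : Set
  Colour = Fin p × Fin p × Fin p × Bool

  sameValuation? : ∀ u v → Dec (valuation u ≡ valuation v)
  sameValuation? u v = valuation u ℕP.≟ valuation v

  pairColour : ℕ → ℕ → Colour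
  pairColour lo hi = digitᶠ lo , digitᶠ hi , digitᶠ (hi ∸ lo) , does (sameValuation? lo hi)

  colourCount : ℕ
  colourCount = p ℕ.* (p ℕ.* (p ℕ.* 2))

  bit : Bool → Fin 2
  bit false = 0F
  bit true  = 1F

  bit-injective : ∀ {b c} → bit b ≡ bit c → b ≡ c
  bit-injective {false} {false} _ = refl
  bit-injective {true}  {true}  _ = refl

  encode : Colour → Fin colourCount
  encode (α , β , γ , φ) = combine α (combine β (combine γ (bit φ)))

  encode-injective : ∀ c c′ → encode c ≡ encode c′ → c ≡ c′
  encode-injective (α , β , γ , φ) (α′ , β′ , γ′ , φ′) eq
    with refl , eq₁ ← combine-injective α _ α′ _ eq
    with refl , eq₂ ← combine-injective β _ β′ _ eq₁
    with refl , eq₃ ← combine-injective γ _ γ′ _ eq₂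
    with refl ← bit-injective eq₃ = refl

  edgeColour : ℕ → ℕ → Fin colourCount
  edgeColour u v = encode (pairColour (u ⊓ v) (u ⊔ v))

  edgeColouring : ∀ N → EdgeColouring colourCount N
  edgeColouring N = edgeColour , λ u v _ _ _ _ →
    cong₂ (λ lo hi → encode (pairColour lo hi)) (ℕP.⊓-comm u v) (ℕP.⊔-comm u v)

  edgeColour-ordered : ∀ {u v} → u ≤ v → edgeColour u v ≡ encode (pairColour u v)
  edgeColour-ordered u≤v =
    cong₂ (λ lo hi → encode (pairColour lo hi)) (ℕP.m≤n⇒m⊓n≡m u≤v) (ℕP.m≤n⇒m⊔n≡n u≤v)

  module Solution (p-prime : Prime p) {k} (a : Fin (suc (suc (suc k))) → ℤ) (small : absSum a < p)
    (x : Fin (suc (suc (suc k))) → ℕ) (positive : ∀ j → 1 ≤ x j)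
    (distinct : ∀ i j → i ≢ j → x i ≢ x j) (solution : linComb a x ≡ + 0)
    (agree : ∀ {i j i′ j′} → x i < x j → x i′ < x j′ → pairColour (x i) (x j) ≡ pairColour (x i′) (x j′))
    (i₀ : Fin (suc (suc (suc k)))) (i₀-least : ∀ j → x i₀ ≤ x j)
    where

    lo-digit : ∀ {i j i′ j′} → x i < x j → x i′ < x j′ → digit (x i) ≡ digit (x i′)
    lo-digit {i} {j} {i′} {j′} lt lt′ = digitᶠ-injective (x i) (x i′) (cong proj₁ (agree lt lt′))

    hi-digit : ∀ {i j i′ j′} → x i < x j → x i′ < x j′ → digit (x j) ≡ digit (x j′)
    hi-digit {i} {j} {i′} {j′} lt lt′ = digitᶠ-injective (x j) (x j′) (cong (proj₁ ∘ proj₂) (agree lt lt′))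

    gap-digit : ∀ {i j i′ j′} → x i < x j → x i′ < x j′ → digit (x j ∸ x i) ≡ digit (x j′ ∸ x i′)
    gap-digit {i} {j} {i′} {j′} lt lt′ =
      digitᶠ-injective (x j ∸ x i) (x j′ ∸ x i′) (cong (proj₁ ∘ proj₂ ∘ proj₂) (agree lt lt′))

    same-valuation : ∀ {i j i′ j′} → x i < x j → x i′ < x j′ →
      does (sameValuation? (x i) (x j)) ≡ does (sameValuation? (x i′) (x j′))
    same-valuation lt lt′ = cong (proj₂ ∘ proj₂ ∘ proj₂) (agree lt lt′)

    ordered : ∀ {i j} → i ≢ j → x i < x j ⊎ x j < x i
    ordered {i} {j} i≢j with ℕP.<-cmp (x i) (x j)
    ... | tri< lt _ _ = inj₁ lt
    ... | tri≈ _ eq _ = ⊥-elim (distinct i j i≢j eq)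
    ... | tri> _ _ gt = inj₂ gt

    -- Two indices besides that of the smallest entry (this is where k ≥ 3 is used).
    j₁ j₂ : Fin (suc (suc (suc k)))
    j₁ = proj₁ (two-others i₀)
    j₂ = proj₁ (proj₂ (two-others i₀))

    j₁≢i₀ : j₁ ≢ i₀
    j₁≢i₀ = proj₁ (proj₂ (proj₂ (two-others i₀)))

    j₂≢i₀ : j₂ ≢ i₀
    j₂≢i₀ = proj₁ (proj₂ (proj₂ (proj₂ (two-others i₀))))

    j₁≢j₂ : j₁ ≢ j₂
    j₁≢j₂ = proj₂ (proj₂ (proj₂ (proj₂ (two-others i₀))))

    above-i₀ : ∀ {j} → j ≢ i₀ → x i₀ < x j
    above-i₀ {j} j≢i₀ = ℕP.≤∧≢⇒< (i₀-least j) (distinct i₀ j (j≢i₀ ∘ sym))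

    -- All entries share one digit: compare j as the larger entry of (i₀, j) and j₁ as the
    -- smaller entry of its pair with j₂ or as the larger one.
    digit-constant : ∀ j → digit (x j) ≡ digit (x i₀)
    digit-constant j with j ≟ i₀
    ... | yes refl = refl
    ... | no  j≢i₀ = trans (hi-digit (above-i₀ j≢i₀) (above-i₀ j₁≢i₀)) digit-j₁
      where
      digit-j₁ : digit (x j₁) ≡ digit (x i₀)
      digit-j₁ with ordered j₁≢j₂
      ... | inj₁ j₁<j₂ = lo-digit j₁<j₂ (above-i₀ j₁≢i₀)
      ... | inj₂ j₂<j₁ = trans (hi-digit (above-i₀ j₁≢i₀) (above-i₀ j₂≢i₀))
                               (lo-digit j₂<j₁ (above-i₀ j₁≢i₀))

    valuations-equal-or-distinct : (∀ j → valuation (x j) ≡ valuation (x i₀))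
                                 ⊎ (∀ i j → i ≢ j → valuation (x i) ≢ valuation (x j))
    valuations-equal-or-distinct with sameValuation? (x i₀) (x j₁)
    ... | yes v₀≡v₁ = inj₁ equal
      where
      same : ∀ {i j} → x i < x j → valuation (x i) ≡ valuation (x j)
      same {i} {j} lt = does-true (sameValuation? (x i) (x j))
        (trans (same-valuation lt (above-i₀ j₁≢i₀)) (dec-true (sameValuation? (x i₀) (x j₁)) v₀≡v₁))
      equal : ∀ j → valuation (x j) ≡ valuation (x i₀)
      equal j with j ≟ i₀
      ... | yes refl = refl
      ... | no  j≢i₀ = sym (same (above-i₀ j≢i₀))
    ... | no  v₀≢v₁ = inj₂ distinctV
      where
      differ : ∀ {i j} → x i < x j → valuation (x i) ≢ valuation (x j)
      differ {i} {j} lt = does-false (sameValuation? (x i) (x j))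
        (trans (same-valuation lt (above-i₀ j₁≢i₀)) (dec-false (sameValuation? (x i₀) (x j₁)) v₀≢v₁))
      distinctV : ∀ i j → i ≢ j → valuation (x i) ≢ valuation (x j)
      distinctV i j i≢j with ordered i≢j
      ... | inj₁ lt = differ lt
      ... | inj₂ gt = differ gt ∘ sym

    -- Distinct valuations force a = 0: at the least valuation among aⱼ ≠ 0 only one term
    -- has a nonzero digit, so that coefficient would vanish.
    distinct-valuations⇒a≡0 : (∀ i j → i ≢ j → valuation (x i) ≢ valuation (x j)) → ∀ j → a j ≡ + 0
    distinct-valuations⇒a≡0 distinctV j with a j ℤP.≟ + 0
    ... | yes aj≡0 = aj≡0
    ... | no  aj≢0 with argminOn (λ j → ¬? (a j ℤP.≟ + 0)) (valuation ∘ x) (j , aj≢0)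
    ...   | i , ai≢0 , i-least = ⊥-elim (ai≢0 (begin
      a i                                 ≡⟨ sumIn-single a i ⟨
      sumIn (λ j → does (j ≟ i)) a
        ≡⟨ level-sum-vanishes p-prime small (digit-indivisible (positive i)) solution level ⟩
      + 0                                 ∎))
      where
      level : ∀ j → Level (valuation (x i)) (digit (x i)) (λ j → does (j ≟ i)) a x j
      level j with j ≟ i
      ... | yes refl = inside (dec-true (i ≟ i) refl) (digitAt-lowest (positive i))
      ... | no  j≢i with a j ℤP.≟ + 0
      ...   | yes aj≡0 = inert (dec-false (j ≟ i) j≢i) aj≡0
      ...   | no  aj≢0 = vanishing (dec-false (j ≟ i) j≢i) (digitAt-above (positive j)
                           (ℕP.≤∧≢⇒< (i-least j aj≢0) (distinctV i j (j≢i ∘ sym))))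

    -- Equal valuations: every term has the same digit at the same level, so Σ aⱼ = 0.
    equal-valuations⇒Σa≡0 : (∀ j → valuation (x j) ≡ valuation (x i₀)) → sumFin a ≡ + 0
    equal-valuations⇒Σa≡0 equalV =
      level-sum-vanishes p-prime small (digit-indivisible (positive i₀)) solution level
      where
      level : ∀ j → Level (valuation (x i₀)) (digit (x i₀)) (λ _ → true) a x j
      level j = inside refl (digitAt-level (positive j) (equalV j) (digit-constant j))

    gap : Fin (suc (suc (suc k))) → ℕ
    gap j = x j ∸ x i₀

    gap-positive : ∀ {j} → j ≢ i₀ → 1 ≤ gap j
    gap-positive j≢i₀ = ℕP.m<n⇒0<n∸m (above-i₀ j≢i₀)

    -- Equal valuations: the gaps again solve the equation and share one digit; the indices
    -- of least gap valuation form the required split.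
    equal-valuations⇒split : (∀ j → valuation (x j) ≡ valuation (x i₀)) → ZeroSumSplit a
    equal-valuations⇒split equalV with argminOn (λ j → ¬? (j ≟ i₀)) (valuation ∘ gap) (j₁ , j₁≢i₀)
    ... | j₀ , j₀≢i₀ , j₀-least =
      B , (j₀ , dec-true (inLevel? j₀) (j₀≢i₀ , refl)) ,
      (i₀ , dec-false (inLevel? i₀) (λ (i₀≢i₀ , _) → i₀≢i₀ refl)) ,
      sumIn-B , complement-vanishes B a total sumIn-B
      where
      total : sumFin a ≡ + 0
      total = equal-valuations⇒Σa≡0 equalV
      t : ℕ
      t = valuation (gap j₀)
      inLevel? : ∀ j → Dec (j ≢ i₀ × valuation (gap j) ≡ t)
      inLevel? j = ¬? (j ≟ i₀) ×-dec (valuation (gap j) ℕP.≟ t)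
      B : Fin (suc (suc (suc k))) → Bool
      B j = does (inLevel? j)
      level : ∀ j → Level t (digit (gap j₀)) B a gap j
      level j = classify (j ≟ i₀) (valuation (gap j) ℕP.≟ t)
        where
        classify : Dec (j ≡ i₀) → Dec (valuation (gap j) ≡ t) → Level t (digit (gap j₀)) B a gap j
        classify (yes refl) _ =
          vanishing (dec-false (inLevel? j) (λ (j≢j , _) → j≢j refl))
                    (subst (λ g → DigitAt t (+ g) (+ 0)) (sym (ℕP.n∸n≡0 (x j))) digitAt-zero)
        classify (no j≢i₀) (yes vj≡t) =
          inside (dec-true (inLevel? j) (j≢i₀ , vj≡t))
                 (digitAt-level (gap-positive j≢i₀) vj≡t (gap-digit (above-i₀ j≢i₀) (above-i₀ j₀≢i₀)))
        classify (no j≢i₀) (no vj≢t) =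
          vanishing (dec-false (inLevel? j) (λ (_ , vj≡t) → vj≢t vj≡t))
                    (digitAt-above (gap-positive j≢i₀) (ℕP.≤∧≢⇒< (j₀-least j j≢i₀) (vj≢t ∘ sym)))
      sumIn-B : sumIn B a ≡ + 0
      sumIn-B = level-sum-vanishes p-prime small (digit-indivisible (gap-positive j₀≢i₀))
                  (linComb-shift a x (x i₀) i₀-least total solution) level

    zero-sum-split : ZeroSumSplit a
    zero-sum-split with valuations-equal-or-distinct
    ... | inj₁ equalV    = equal-valuations⇒split equalV
    ... | inj₂ distinctV = zero-coefficients⇒split (distinct-valuations⇒a≡0 distinctV)
      where
      zero-coefficients⇒split : (∀ j → a j ≡ + 0) → ZeroSumSplit a
      zero-coefficients⇒split a≡0 =
        I , (0F , refl) , (1F , refl) , sumIn-I , complement-vanishes I a (sumFin-zero a a≡0) sumIn-I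
        where
        I : Fin (suc (suc (suc k))) → Bool
        I j = does (j ≟ 0F)
        sumIn-I : sumIn I a ≡ + 0
        sumIn-I = trans (sumIn-single a 0F) (a≡0 0F)

  monochromatic⇒split : Prime p → ∀ {k} (a : Fin (suc (suc (suc k))) → ℤ) → absSum a < p →
                        ∀ {N} x → MonoSolution a N edgeColour x → ZeroSumSplit a
  monochromatic⇒split p-prime a small x (inRange , solution , distinct , colour , mono)
    with argminOn {P = λ _ → ⊤} (λ _ → yes tt) x (0F , tt)
  ... | i₀ , _ , i₀-least =
    Solution.zero-sum-split p-prime a small x (proj₁ ∘ inRange) distinct solution agree
                            i₀ (λ j → i₀-least j tt)
    where
    agree : ∀ {i j i′ j′} → x i < x j → x i′ < x j′ → pairColour (x i) (x j) ≡ pairColour (x i′) (x j′)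
    agree {i} {j} {i′} {j′} lt lt′ = encode-injective _ _ (begin
      encode (pairColour (x i) (x j))    ≡⟨ edgeColour-ordered (ℕP.<⇒≤ lt) ⟨
      edgeColour (x i) (x j)             ≡⟨ mono i j (λ i≡j → ℕP.<⇒≢ lt (cong x i≡j)) ⟩
      colour                             ≡⟨ mono i′ j′ (λ i≡j → ℕP.<⇒≢ lt′ (cong x i≡j)) ⟨
      edgeColour (x i′) (x j′)           ≡⟨ edgeColour-ordered (ℕP.<⇒≤ lt′) ⟩
      encode (pairColour (x i′) (x j′))  ∎)

theorem3p2 : (k : ℕ) → 3 ≤ k → (a : Fin k → ℤ) → GraphRegular a →
    Σ (Fin k → Bool) λ I →
    (∃ λ i → I i ≡ true) × (∃ λ j → I j ≡ false) ×
    (sumIn I a ≡ + 0) × (sumOut I a ≡ + 0)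
theorem3p2 _ (s≤s (s≤s (s≤s _))) a (NA , regular) with prime-above (absSum a)
... | p , p-prime , small = monochromatic⇒split p-prime a small (proj₁ solution) (proj₂ solution)
  where
  open PAdic p {{prime⇒nonTrivial p-prime}} using (colourCount; edgeColouring; edgeColour; monochromatic⇒split)
  N : ℕ
  N = suc (NA colourCount)
  solution : ∃ λ x → MonoSolution a N edgeColour x
  solution = regular colourCount N ℕP.≤-refl (edgeColouring N)
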